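{- For every integer $m\geq1$, \[ \sum_{j=1}^{m-1}\partial_{m-j}(z_{j})=-(m-1)z_{m}. \]
   Context: $\mathfrak{h}=\mathbb{Q}\langle x,y\rangle$, $z_k=yx^{k-1}$. For $n\ge1$, $\partial_n$ is the derivation of $\mathfrak{h}$ determined by $\partial_{n}(x)=y(x+y)^{n-1}x$, $\partial_{n}(y)=-y(x+y)^{n-1}x$. -}

module Defs where

open import Data.Nat as ℕ using (ℕ; zero; suc; _∸_)
open import Data.Rational as ℚ using (ℚ; 0ℚ; 1ℚ; _+_; _*_; -_)
open import Data.List using (List; []; _∷_; _++_; [_]; map; concatMap; replicate; upTo)
open import Data.Product using (_×_; _,_)
open import Relation.Nullary using (yes; no)
open import Relation.Binary.PropositionalEquality using (_≡_)
open import Relation.Binary using (DecidableEquality)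
import Data.List.Properties as LP

data Letter : Set where
  X Y : Letter

_≟L_ : DecidableEquality Letter
X ≟L X = yes _≡_.refl
X ≟L Y = no λ ()
Y ≟L X = no λ ()
Y ≟L Y = yes _≡_.refl

Word : Set
Word = List Letter

_≟W_ : DecidableEquality Word
_≟W_ = LP.≡-dec _≟L_

-- An element of 𝔥 is represented by a finite formal ℚ-linear combination of words.
Poly : Set
Poly = List (ℚ × Word)

coeff : Poly → Word → ℚ
coeff [] w = 0ℚ
coeff ((c , u) ∷ p) w with u ≟W w
... | yes _ = c + coeff p w
... | no  _ = coeff p w

_≈_ : Poly → Poly → Set
p ≈ q = ∀ w → coeff p w ≡ coeff q w

infix 4 _≈_

0P : Poly
0P = []

_⊕_ : Poly → Poly → Poly
p ⊕ q = p ++ q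

_·_ : ℚ → Poly → Poly
c · p = map (λ { (a , w) → (c * a , w) }) p

_⊗_ : Poly → Poly → Poly
p ⊗ q = concatMap (λ { (a , u) → map (λ { (b , v) → (a * b , u ++ v) }) q }) p

word : Word → Poly
word w = [ (1ℚ , w) ]

x y : Poly
x = word (X ∷ [])
y = word (Y ∷ [])

∑ : List Poly → Poly
∑ [] = 0P
∑ (p ∷ ps) = p ⊕ ∑ ps

allWords : ℕ → List Word
allWords zero = [] ∷ []
allWords (suc n) = concatMap (λ w → (X ∷ w) ∷ (Y ∷ w) ∷ []) (allWords n)

_^_ : Poly → ℕ → Poly
p ^ zero = word []
p ^ suc n = p ⊗ (p ^ n)

derivWord : (Letter → Poly) → Word → Poly
derivWord f [] = 0P
derivWord f (a ∷ w) = (f a ⊗ word w) ⊕ (word (a ∷ []) ⊗ derivWord f w)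

deriv : (Letter → Poly) → Poly → Poly
deriv f p = concatMap (λ { (c , w) → c · derivWord f w }) p

-- ∂_n for n ≥ 1: ∂_n(x) = y(x+y)^{n-1}x, ∂_n(y) = -y(x+y)^{n-1}x.
-- (∂ 0 is never used; it is set to the zero derivation.)
∂gen : ℕ → Letter → Poly
∂gen zero _ = 0P
∂gen (suc k) X = y ⊗ (((x ⊕ y) ^ k) ⊗ x)
∂gen (suc k) Y = (- 1ℚ) · (y ⊗ (((x ⊕ y) ^ k) ⊗ x))

∂ : ℕ → Poly → Poly
∂ n = deriv (∂gen n)

z : ℕ → Poly
z k = word (Y ∷ replicate (k ∸ 1) X)

{-# OPTIONS --safe #-}
module Submission where

-- Polynomials are compared through their pairings ⟪ p ∣ f ⟫ = Σ c·f(w) with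
-- arbitrary weights f : Word → ℚ; a coefficient is the pairing with an indicator,
-- and products and derivations turn into substitutions inside f.
-- Put S n = Σ_{i<n} ∂_{n-i}(y xⁱ). The Leibniz rule on y xⁱ⁺¹ = (y xⁱ) x gives
--   S (n+1) = ∂_{n+1}(y) + S n · x + Σ_{i<n} y xⁱ ∂_{n-i}(x),
-- and expanding (x+y)ⁿ = xⁿ + Σ_{i<n} xⁱ y (x+y)ⁿ⁻¹⁻ⁱ gives
--   ∂_{n+1}(x) = y xⁿ⁺¹ + Σ_{i<n} y xⁱ ∂_{n-i}(x).
-- Since ∂_{n+1}(y) = -∂_{n+1}(x) the two sums cancel, so S (n+1) = -y xⁿ⁺¹ + S n · x,
-- and S n = -n y xⁿ follows by induction.

open import Defs
open import Data.Nat using (ℕ; zero; suc; _∸_; _≤_; s≤s; z≤n)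
open import Data.Integer using (+_)
import Data.Integer as ℤ
import Data.Integer.Properties as ℤ
open import Data.Rational using (ℚ; mkℚ; 0ℚ; 1ℚ; _+_; _*_; -_; _/_)
open import Data.Rational.Properties
  using (+-identityˡ; +-identityʳ; *-identityˡ; *-identityʳ; *-zeroˡ; *-zeroʳ;
         +-assoc; +-comm; *-assoc; *-distribˡ-+; +-0-commutativeMonoid;
         normalize-coprime; toℚᵘ-injective; toℚᵘ-homo-+)
open import Data.Rational.Solver using (module +-*-Solver)
import Data.Rational.Unnormalised as ℚᵘ
import Data.Rational.Unnormalised.Properties as ℚᵘ
import Data.Nat.Coprimality as Coprimality
open import Algebra.Bundles using (CommutativeMonoid)
open import Algebra.Properties.CommutativeSemigroup (CommutativeMonoid.commutativeSemigroup +-0-commutativeMonoid)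
  using (interchange)
open import Data.List using ([]; _∷_; _++_; [_]; map; replicate; applyUpTo; upTo)
open import Data.List.Properties using (++-assoc; ++-identityʳ)
open import Data.Product using (_×_; _,_)
open import Data.Bool using (if_then_else_)
open import Relation.Nullary.Decidable using (⌊_⌋; yes; no)
open import Relation.Binary.PropositionalEquality using (_≡_; refl; sym; trans; cong; cong₂; module ≡-Reasoning)

+[1+n]/1≡1+n/1 : ∀ n → + suc n / 1 ≡ 1ℚ + + n / 1
+[1+n]/1≡1+n/1 n = begin
  + suc n / 1                         ≡⟨ normalize-coprime (coprime-1 (suc n)) ⟩
  mkℚ (+ suc n) 0 (coprime-1 (suc n)) ≡⟨ toℚᵘ-injective (ℚᵘ.≃-trans (ℚᵘ.*≡* cross) (ℚᵘ.≃-sym (toℚᵘ-homo-+ 1ℚ n/1))) ⟩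
  1ℚ + n/1                            ≡⟨ cong (λ q → 1ℚ + q) (sym (normalize-coprime (coprime-1 n))) ⟩
  1ℚ + + n / 1                        ∎
  where
  open ≡-Reasoning
  coprime-1 : ∀ k → Coprimality.Coprime k 1
  coprime-1 k = Coprimality.sym (Coprimality.1-coprimeTo k)
  n/1 : ℚ
  n/1 = mkℚ (+ n) 0 (coprime-1 n)
  cross : + suc n ℤ.* (+ 1 ℤ.* + 1) ≡ (+ 1 ℤ.* + 1 ℤ.+ + n ℤ.* + 1) ℤ.* + 1
  cross = trans (ℤ.*-identityʳ _) (sym (trans (ℤ.*-identityʳ _) (cong (λ k → + 1 ℤ.+ k) (ℤ.*-identityʳ (+ n)))))

m<n⇒n∸m≡suc[n∸suc[m]] : ∀ {m n} → suc m ≤ n → n ∸ m ≡ suc (n ∸ suc m)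
m<n⇒n∸m≡suc[n∸suc[m]] {zero}  (s≤s _)   = refl
m<n⇒n∸m≡suc[n∸suc[m]] {suc m} (s≤s m<n) = m<n⇒n∸m≡suc[n∸suc[m]] m<n

replicate-∷ʳ : ∀ {A : Set} n (a : A) → replicate n a ++ [ a ] ≡ a ∷ replicate n a
replicate-∷ʳ zero    a = refl
replicate-∷ʳ (suc n) a = cong (a ∷_) (replicate-∷ʳ n a)

sumBelow : ℕ → (ℕ → ℚ) → ℚ
sumBelow zero    t = 0ℚ
sumBelow (suc n) t = t 0 + sumBelow n (λ i → t (suc i))

sumBelow-cong : ∀ n {s t : ℕ → ℚ} → (∀ i → suc i ≤ n → s i ≡ t i) → sumBelow n s ≡ sumBelow n t
sumBelow-cong zero    s≗t = refl
sumBelow-cong (suc n) s≗t = cong₂ _+_ (s≗t 0 (s≤s z≤n)) (sumBelow-cong n (λ i i<n → s≗t (suc i) (s≤s i<n)))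

sumBelow-distrib-+ : ∀ n (s t : ℕ → ℚ) → sumBelow n (λ i → s i + t i) ≡ sumBelow n s + sumBelow n t
sumBelow-distrib-+ zero    s t = sym (+-identityˡ 0ℚ)
sumBelow-distrib-+ (suc n) s t =
  trans (cong (λ r → s 0 + t 0 + r) (sumBelow-distrib-+ n _ _)) (interchange (s 0) (t 0) _ _)

⟪_∣_⟫ : Poly → (Word → ℚ) → ℚ
⟪ []          ∣ f ⟫ = 0ℚ
⟪ (c , w) ∷ p ∣ f ⟫ = c * f w + ⟪ p ∣ f ⟫

⟪⟫-cong : ∀ p {f g : Word → ℚ} → (∀ w → f w ≡ g w) → ⟪ p ∣ f ⟫ ≡ ⟪ p ∣ g ⟫
⟪⟫-cong []            f≗g = refl
⟪⟫-cong ((c , w) ∷ p) f≗g = cong₂ (λ a b → c * a + b) (f≗g w) (⟪⟫-cong p f≗g)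

⟪⟫-⊕ : ∀ p q f → ⟪ p ⊕ q ∣ f ⟫ ≡ ⟪ p ∣ f ⟫ + ⟪ q ∣ f ⟫
⟪⟫-⊕ []            q f = sym (+-identityˡ _)
⟪⟫-⊕ ((c , w) ∷ p) q f = trans (cong (λ r → c * f w + r) (⟪⟫-⊕ p q f)) (sym (+-assoc (c * f w) _ _))

⟪⟫-· : ∀ c p f → ⟪ c · p ∣ f ⟫ ≡ c * ⟪ p ∣ f ⟫
⟪⟫-· c []            f = sym (*-zeroʳ c)
⟪⟫-· c ((a , w) ∷ p) f = trans (cong₂ _+_ (*-assoc c a (f w)) (⟪⟫-· c p f)) (sym (*-distribˡ-+ c _ _))

⟪⟫-word : ∀ w f → ⟪ word w ∣ f ⟫ ≡ f w
⟪⟫-word w f = trans (+-identityʳ _) (*-identityˡ _)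

⟪⟫-·-word : ∀ c w f → ⟪ c · word w ∣ f ⟫ ≡ c * f w
⟪⟫-·-word c w f = trans (⟪⟫-· c (word w) f) (cong (c *_) (⟪⟫-word w f))

-- Stated for an arbitrary h, since the pattern lambda that _⊗_ maps over q cannot be named here.
⟪⟫-map-scale-prefix : ∀ a u q f (h : ℚ × Word → ℚ × Word) → (∀ b v → h (b , v) ≡ (a * b , u ++ v)) →
                      ⟪ map h q ∣ f ⟫ ≡ a * ⟪ q ∣ (λ v → f (u ++ v)) ⟫
⟪⟫-map-scale-prefix a u []            f h h≗ = sym (*-zeroʳ a)
⟪⟫-map-scale-prefix a u ((b , v) ∷ q) f h h≗ rewrite h≗ b v =
  trans (cong₂ _+_ (*-assoc a b _) (⟪⟫-map-scale-prefix a u q f h h≗)) (sym (*-distribˡ-+ a _ _))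

⟪⟫-⊗ : ∀ p q f → ⟪ p ⊗ q ∣ f ⟫ ≡ ⟪ p ∣ (λ u → ⟪ q ∣ (λ v → f (u ++ v)) ⟫) ⟫
⟪⟫-⊗ []            q f = refl
⟪⟫-⊗ ((a , u) ∷ p) q f =
  trans (⟪⟫-⊕ (map _ q) (p ⊗ q) f)
        (cong₂ _+_ (⟪⟫-map-scale-prefix a u q f _ (λ _ _ → refl)) (⟪⟫-⊗ p q f))

⟪⟫-∑-applyUpTo : ∀ (h : ℕ → Poly) (g : ℕ → ℕ) n f →
                 ⟪ ∑ (map h (applyUpTo g n)) ∣ f ⟫ ≡ sumBelow n (λ i → ⟪ h (g i) ∣ f ⟫)
⟪⟫-∑-applyUpTo h g zero    f = refl
⟪⟫-∑-applyUpTo h g (suc n) f =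
  trans (⟪⟫-⊕ (h (g 0)) _ f) (cong (λ r → ⟪ h (g 0) ∣ f ⟫ + r) (⟪⟫-∑-applyUpTo h (λ i → g (suc i)) n f))

δ : Word → Word → ℚ
δ w u = if ⌊ u ≟W w ⌋ then 1ℚ else 0ℚ

coeff≡⟪⟫-δ : ∀ p w → coeff p w ≡ ⟪ p ∣ δ w ⟫
coeff≡⟪⟫-δ []            w = refl
coeff≡⟪⟫-δ ((c , u) ∷ p) w with u ≟W w
... | yes _ = cong₂ _+_ (sym (*-identityʳ c)) (coeff≡⟪⟫-δ p w)
... | no  _ = trans (coeff≡⟪⟫-δ p w) (sym (trans (cong (_+ ⟪ p ∣ δ w ⟫) (*-zeroʳ c)) (+-identityˡ _)))

⟪⟫-deriv : ∀ g p f → ⟪ deriv g p ∣ f ⟫ ≡ ⟪ p ∣ (λ w → ⟪ derivWord g w ∣ f ⟫) ⟫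
⟪⟫-deriv g []            f = refl
⟪⟫-deriv g ((c , w) ∷ p) f =
  trans (⟪⟫-⊕ (c · derivWord g w) (deriv g p) f) (cong₂ _+_ (⟪⟫-· c (derivWord g w) f) (⟪⟫-deriv g p f))

⟪⟫-deriv-word : ∀ g w f → ⟪ deriv g (word w) ∣ f ⟫ ≡ ⟪ derivWord g w ∣ f ⟫
⟪⟫-deriv-word g w f = trans (⟪⟫-deriv g (word w) f) (⟪⟫-word w (λ v → ⟪ derivWord g v ∣ f ⟫))

⟪⟫-derivWord-∷ : ∀ g a w f →
  ⟪ derivWord g (a ∷ w) ∣ f ⟫ ≡ ⟪ g a ∣ (λ u → f (u ++ w)) ⟫ + ⟪ derivWord g w ∣ (λ u → f (a ∷ u)) ⟫
⟪⟫-derivWord-∷ g a w f =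
  trans (⟪⟫-⊕ (g a ⊗ word w) _ f)
        (cong₂ _+_ (trans (⟪⟫-⊗ (g a) (word w) f) (⟪⟫-cong (g a) (λ u → ⟪⟫-word w (λ v → f (u ++ v)))))
                   (trans (⟪⟫-⊗ (word [ a ]) (derivWord g w) f)
                          (⟪⟫-word [ a ] (λ u → ⟪ derivWord g w ∣ (λ v → f (u ++ v)) ⟫))))

⟪⟫-derivWord-letter : ∀ g a f → ⟪ derivWord g [ a ] ∣ f ⟫ ≡ ⟪ g a ∣ f ⟫
⟪⟫-derivWord-letter g a f =
  trans (⟪⟫-derivWord-∷ g a [] f)
        (trans (+-identityʳ _) (⟪⟫-cong (g a) (λ u → cong f (++-identityʳ u))))

⟪⟫-derivWord-++ : ∀ g u v f →
  ⟪ derivWord g (u ++ v) ∣ f ⟫ ≡ ⟪ derivWord g u ∣ (λ t → f (t ++ v)) ⟫ + ⟪ derivWord g v ∣ (λ t → f (u ++ t)) ⟫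
⟪⟫-derivWord-++ g []      v f = sym (+-identityˡ _)
⟪⟫-derivWord-++ g (a ∷ u) v f = begin
  ⟪ derivWord g (a ∷ (u ++ v)) ∣ f ⟫
    ≡⟨ ⟪⟫-derivWord-∷ g a (u ++ v) f ⟩
  A + ⟪ derivWord g (u ++ v) ∣ (λ t → f (a ∷ t)) ⟫
    ≡⟨ cong (λ r → A + r) (⟪⟫-derivWord-++ g u v (λ t → f (a ∷ t))) ⟩
  A + (B + C)
    ≡⟨ sym (+-assoc A B C) ⟩
  (A + B) + C
    ≡⟨ cong (λ r → (r + B) + C) (⟪⟫-cong (g a) (λ t → cong f (sym (++-assoc t u v)))) ⟩
  (⟪ g a ∣ (λ t → f ((t ++ u) ++ v)) ⟫ + B) + C
    ≡⟨ cong (_+ C) (sym (⟪⟫-derivWord-∷ g a u (λ t → f (t ++ v)))) ⟩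
  ⟪ derivWord g (a ∷ u) ∣ (λ t → f (t ++ v)) ⟫ + C ∎
  where
  open ≡-Reasoning
  A = ⟪ g a ∣ (λ t → f (t ++ (u ++ v))) ⟫
  B = ⟪ derivWord g u ∣ (λ t → f (a ∷ t ++ v)) ⟫
  C = ⟪ derivWord g v ∣ (λ t → f (a ∷ u ++ t)) ⟫

⟪⟫-[x⊕y]^suc : ∀ n f →
  ⟪ (x ⊕ y) ^ suc n ∣ f ⟫ ≡ ⟪ (x ⊕ y) ^ n ∣ (λ v → f (X ∷ v)) ⟫ + ⟪ (x ⊕ y) ^ n ∣ (λ v → f (Y ∷ v)) ⟫
⟪⟫-[x⊕y]^suc n f =
  trans (⟪⟫-⊗ (x ⊕ y) ((x ⊕ y) ^ n) f)
        (cong₂ _+_ (*-identityˡ ⟪ (x ⊕ y) ^ n ∣ (λ v → f (X ∷ v)) ⟫)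
                   (trans (+-identityʳ _) (*-identityˡ ⟪ (x ⊕ y) ^ n ∣ (λ v → f (Y ∷ v)) ⟫)))

⟪⟫-[x⊕y]^-expand : ∀ n f →
  ⟪ (x ⊕ y) ^ n ∣ f ⟫ ≡
  f (replicate n X) + sumBelow n (λ i → ⟪ (x ⊕ y) ^ (n ∸ suc i) ∣ (λ v → f (replicate i X ++ Y ∷ v)) ⟫)
⟪⟫-[x⊕y]^-expand zero    f = trans (⟪⟫-word [] f) (sym (+-identityʳ _))
⟪⟫-[x⊕y]^-expand (suc n) f = begin
  ⟪ (x ⊕ y) ^ suc n ∣ f ⟫                 ≡⟨ ⟪⟫-[x⊕y]^suc n f ⟩
  ⟪ (x ⊕ y) ^ n ∣ (λ v → f (X ∷ v)) ⟫ + b ≡⟨ cong (_+ b) (⟪⟫-[x⊕y]^-expand n (λ v → f (X ∷ v))) ⟩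
  (a + s) + b                             ≡⟨ +-assoc a s b ⟩
  a + (s + b)                             ≡⟨ cong (λ r → a + r) (+-comm s b) ⟩
  a + (b + s)                             ∎
  where
  open ≡-Reasoning
  a = f (X ∷ replicate n X)
  b = ⟪ (x ⊕ y) ^ n ∣ (λ v → f (Y ∷ v)) ⟫
  s = sumBelow n (λ i → ⟪ (x ⊕ y) ^ (n ∸ suc i) ∣ (λ v → f (X ∷ replicate i X ++ Y ∷ v)) ⟫)

⟪⟫-∂gen-suc-X : ∀ n f → ⟪ ∂gen (suc n) X ∣ f ⟫ ≡ ⟪ (x ⊕ y) ^ n ∣ (λ v → f (Y ∷ v ++ [ X ])) ⟫
⟪⟫-∂gen-suc-X n f =
  trans (⟪⟫-⊗ y (((x ⊕ y) ^ n) ⊗ x) f)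
        (trans (⟪⟫-word [ Y ] (λ u → ⟪ ((x ⊕ y) ^ n) ⊗ x ∣ (λ v → f (u ++ v)) ⟫))
               (trans (⟪⟫-⊗ ((x ⊕ y) ^ n) x (λ v → f (Y ∷ v)))
                      (⟪⟫-cong ((x ⊕ y) ^ n) (λ u → ⟪⟫-word [ X ] (λ v → f (Y ∷ u ++ v))))))

⟪⟫-∂gen-X-recursion : ∀ n f →
  ⟪ ∂gen (suc n) X ∣ f ⟫ ≡
  f (Y ∷ replicate (suc n) X) + sumBelow n (λ i → ⟪ ∂gen (n ∸ i) X ∣ (λ u → f (Y ∷ replicate i X ++ u)) ⟫)
⟪⟫-∂gen-X-recursion n f = begin
  ⟪ ∂gen (suc n) X ∣ f ⟫
    ≡⟨ ⟪⟫-∂gen-suc-X n f ⟩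
  ⟪ (x ⊕ y) ^ n ∣ (λ v → f (Y ∷ v ++ [ X ])) ⟫
    ≡⟨ ⟪⟫-[x⊕y]^-expand n _ ⟩
  f (Y ∷ replicate n X ++ [ X ]) + _
    ≡⟨ cong₂ _+_ (cong (λ w → f (Y ∷ w)) (replicate-∷ʳ n X)) (sumBelow-cong n lower-term) ⟩
  f (Y ∷ replicate (suc n) X) + sumBelow n (λ i → ⟪ ∂gen (n ∸ i) X ∣ (λ u → f (Y ∷ replicate i X ++ u)) ⟫) ∎
  where
  open ≡-Reasoning
  lower-term : ∀ i → suc i ≤ n →
    ⟪ (x ⊕ y) ^ (n ∸ suc i) ∣ (λ v → f (Y ∷ (replicate i X ++ Y ∷ v) ++ [ X ])) ⟫ ≡
    ⟪ ∂gen (n ∸ i) X ∣ (λ u → f (Y ∷ replicate i X ++ u)) ⟫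
  lower-term i i<n rewrite m<n⇒n∸m≡suc[n∸suc[m]] i<n =
    sym (trans (⟪⟫-∂gen-suc-X (n ∸ suc i) _)
               (⟪⟫-cong ((x ⊕ y) ^ (n ∸ suc i)) (λ v → cong (λ w → f (Y ∷ w)) (sym (++-assoc (replicate i X) (Y ∷ v) [ X ])))))

⟪⟫-∂-z[1+i]x : ∀ c i f →
  ⟪ ∂ c (z (suc (suc i))) ∣ f ⟫ ≡ ⟪ ∂ c (z (suc i)) ∣ (λ u → f (u ++ [ X ])) ⟫ + ⟪ ∂gen c X ∣ (λ u → f (Y ∷ replicate i X ++ u)) ⟫
⟪⟫-∂-z[1+i]x c i f = begin
  ⟪ ∂ c (z (suc (suc i))) ∣ f ⟫
    ≡⟨ ⟪⟫-deriv-word (∂gen c) (Y ∷ X ∷ replicate i X) f ⟩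
  ⟪ derivWord (∂gen c) (Y ∷ X ∷ replicate i X) ∣ f ⟫
    ≡⟨ cong (λ w → ⟪ derivWord (∂gen c) (Y ∷ w) ∣ f ⟫) (sym (replicate-∷ʳ i X)) ⟩
  ⟪ derivWord (∂gen c) ((Y ∷ replicate i X) ++ [ X ]) ∣ f ⟫
    ≡⟨ ⟪⟫-derivWord-++ (∂gen c) (Y ∷ replicate i X) [ X ] f ⟩
  ⟪ derivWord (∂gen c) (Y ∷ replicate i X) ∣ (λ u → f (u ++ [ X ])) ⟫ + ⟪ derivWord (∂gen c) [ X ] ∣ _ ⟫
    ≡⟨ cong₂ _+_ (sym (⟪⟫-deriv-word (∂gen c) (Y ∷ replicate i X) _)) (⟪⟫-derivWord-letter (∂gen c) X _) ⟩
  ⟪ ∂ c (z (suc i)) ∣ (λ u → f (u ++ [ X ])) ⟫ + ⟪ ∂gen c X ∣ (λ u → f (Y ∷ replicate i X ++ u)) ⟫ ∎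
  where open ≡-Reasoning

⟪⟫-∂[1+n]y : ∀ n f → ⟪ ∂ (suc n) y ∣ f ⟫ ≡ - 1ℚ * ⟪ ∂gen (suc n) X ∣ f ⟫
⟪⟫-∂[1+n]y n f =
  trans (⟪⟫-deriv-word (∂gen (suc n)) [ Y ] f)
        (trans (⟪⟫-derivWord-letter (∂gen (suc n)) Y f) (⟪⟫-· (- 1ℚ) (∂gen (suc n) X) f))

⟪⟫-∑∂z : ∀ n f → sumBelow n (λ i → ⟪ ∂ (n ∸ i) (z (suc i)) ∣ f ⟫) ≡ - (+ n / 1) * f (Y ∷ replicate n X)
⟪⟫-∑∂z zero    f = sym (*-zeroˡ (f [ Y ]))
⟪⟫-∑∂z (suc n) f = begin
  ⟪ ∂ (suc n) y ∣ f ⟫ + sumBelow n (λ i → ⟪ ∂ (n ∸ i) (z (suc (suc i))) ∣ f ⟫)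
    ≡⟨ cong₂ _+_ (trans (⟪⟫-∂[1+n]y n f) (cong (- 1ℚ *_) (⟪⟫-∂gen-X-recursion n f)))
                 (trans (sumBelow-cong n (λ i _ → ⟪⟫-∂-z[1+i]x (n ∸ i) i f)) (sumBelow-distrib-+ n _ _)) ⟩
  - 1ℚ * (a + E) + (sumBelow n (λ i → ⟪ ∂ (n ∸ i) (z (suc i)) ∣ f[-x] ⟫) + E)
    ≡⟨ cong (λ r → - 1ℚ * (a + E) + (r + E)) (⟪⟫-∑∂z n f[-x]) ⟩
  - 1ℚ * (a + E) + (- (+ n / 1) * f (Y ∷ replicate n X ++ [ X ]) + E)
    ≡⟨ cong (λ w → - 1ℚ * (a + E) + (- (+ n / 1) * f (Y ∷ w) + E)) (replicate-∷ʳ n X) ⟩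
  - 1ℚ * (a + E) + (- (+ n / 1) * a + E)
    ≡⟨ cancel-lower-terms a E (+ n / 1) ⟩
  - (1ℚ + + n / 1) * a
    ≡⟨ cong (λ q → - q * a) (sym (+[1+n]/1≡1+n/1 n)) ⟩
  - (+ suc n / 1) * a ∎
  where
  open ≡-Reasoning
  f[-x] : Word → ℚ
  f[-x] u = f (u ++ [ X ])
  a = f (Y ∷ replicate (suc n) X)
  E = sumBelow n (λ i → ⟪ ∂gen (n ∸ i) X ∣ (λ u → f (Y ∷ replicate i X ++ u)) ⟫)
  cancel-lower-terms : ∀ a e q → - 1ℚ * (a + e) + (- q * a + e) ≡ - (1ℚ + q) * a
  cancel-lower-terms = solve 3 (λ a e q → (:- con 1ℚ) :* (a :+ e) :+ ((:- q) :* a :+ e) := (:- (con 1ℚ :+ q)) :* a) refl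
    where open +-*-Solver

lemma5p6 : (m : ℕ) → 1 ≤ m →
    ∑ (map (λ i → ∂ (m ∸ suc i) (z (suc i))) (upTo (m ∸ 1)))
      ≈ (- ((+ (m ∸ 1)) / 1)) · z m
lemma5p6 (suc n) _ w = begin
  coeff S w                                            ≡⟨ coeff≡⟪⟫-δ S w ⟩
  ⟪ S ∣ δ w ⟫                                          ≡⟨ ⟪⟫-∑-applyUpTo _ (λ i → i) n (δ w) ⟩
  sumBelow n (λ i → ⟪ ∂ (n ∸ i) (z (suc i)) ∣ δ w ⟫)   ≡⟨ ⟪⟫-∑∂z n (δ w) ⟩
  - (+ n / 1) * δ w (Y ∷ replicate n X)                ≡⟨ sym (⟪⟫-·-word (- (+ n / 1)) (Y ∷ replicate n X) (δ w)) ⟩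
  ⟪ (- (+ n / 1)) · z (suc n) ∣ δ w ⟫                  ≡⟨ sym (coeff≡⟪⟫-δ ((- (+ n / 1)) · z (suc n)) w) ⟩
  coeff ((- (+ n / 1)) · z (suc n)) w                  ∎
  where
  open ≡-Reasoning
  S = ∑ (map (λ i → ∂ (suc n ∸ suc i) (z (suc i))) (upTo n))
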